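{- Let $F$ be a finite set of connected oriented graphs. Then there exist a set $A$ of words over the alphabet $\{\leftarrow,\rightarrow\}$ and a positive integer $m$ such that for every positive integer $k$: (1) if $k\ge m$, the path with $k$ edges admits an $F$-free orientation if and only if there is a word of length $k$ in $\mathcal{L}_A$; (2) if $k\ge \max\{m,4\}$, the cycle with $k$ edges admits an $F$-free orientation if and only if there is a $k$-periodic word in $\mathcal{L}_A$; (3) if $k\ge \max\{m,4\}$, the cycle with $k$ edges admits an acyclic $F$-free orientation if and only if there is a non-constant $k$-periodic word in $\mathcal{L}_A$.
   Context: Graphs are finite, loopless, without parallel edges. An oriented graph is a digraph without loops, parallel arcs or pairs of opposite arcs; an orientation of a graph is obtained by giving each edge a direction; it is acyclic if it has no directed cycle. For a set $F$ of oriented graphs, an oriented graph is $F$-free if no member of $F$ is isomorphic to an induced subdigraph of it. Words: finite sequences over the alphabet; $|a|$ is the length, $ab$ concatenation, $a^n$ the $n$-fold concatenation ($a^0$ the empty word). A factor of $b$ is a word $a$ with $b=cad$ for some words $c,d$. For a set $A$ of words, $\mathcal{L}_A$ is the set of words having no factor in $A$. A word $a\in\mathcal{L}$ is $k$-periodic in a language $\mathcal{L}$ if $|a|=k$ and $a^n\in\mathcal{L}$ for all $n\ge1$. A word is constant if all its symbols are equal. -}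

module Defs where

open import Level using (0ℓ)
open import Data.Nat using (ℕ; zero; suc; _≤_)
open import Data.Fin using (Fin; toℕ)
open import Data.List using (List; []; _∷_; _++_; length; replicate; concat)
open import Data.List.Relation.Unary.All using (All)
open import Data.List.Relation.Unary.Any using (Any)
open import Data.Product using (Σ; ∃; _×_; _,_)
open import Data.Sum using (_⊎_)
open import Data.Empty using (⊥)
open import Relation.Nullary using (¬_)
open import Relation.Binary.PropositionalEquality using (_≡_)
open import Function.Definitions using (Injective)
open import Function.Bundles using (_⇔_)

Rel : ℕ → Set₁
Rel n = Fin n → Fin n → Set

IsOriented : ∀ {n} → Rel n → Set
IsOriented {n} D = (∀ (x : Fin n) → ¬ D x x) × (∀ (x y : Fin n) → D x y → ¬ D y x)

record OGraph : Set₁ where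
  constructor ograph
  field
    size     : ℕ
    arc      : Rel size
    oriented : IsOriented arc
open OGraph public

data UReach {n} (R : Rel n) : Fin n → Fin n → Set where
  here : ∀ {x} → UReach R x x
  step : ∀ {x y z} → (R x y ⊎ R y x) → UReach R y z → UReach R x z

data DWalk {n} (R : Rel n) : Fin n → Fin n → Set where
  one  : ∀ {x y} → R x y → DWalk R x y
  more : ∀ {x y z} → R x y → DWalk R y z → DWalk R x z

Connected : OGraph → Set
Connected H = ∀ (x y : Fin (size H)) → UReach (arc H) x y

Acyclic : ∀ {n} → Rel n → Set
Acyclic {n} D = ∀ (x : Fin n) → ¬ DWalk D x x

InducedIn : OGraph → ∀ {n} → Rel n → Set
InducedIn H {n} D =
  Σ (Fin (size H) → Fin n) λ f →
    Injective _≡_ _≡_ f × (∀ x y → arc H x y ⇔ D (f x) (f y))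

Free : List OGraph → ∀ {n} → Rel n → Set₁
Free F D = All (λ H → ¬ InducedIn H D) F

IsOrientationOf : ∀ {n} → Rel n → Rel n → Set
IsOrientationOf {n} E D = IsOriented D × (∀ (x y : Fin n) → E x y ⇔ (D x y ⊎ D y x))

PathEdge : (k : ℕ) → Rel (suc k)
PathEdge k i j = (toℕ j ≡ suc (toℕ i)) ⊎ (toℕ i ≡ suc (toℕ j))

-- Cycle with k edges: vertices 0..k-1, edges {i,i+1 mod k}.
CycNext : (k : ℕ) → Rel k
CycNext k i j = (toℕ j ≡ suc (toℕ i)) ⊎ ((suc (toℕ i) ≡ k) × (toℕ j ≡ 0))

CycleEdge : (k : ℕ) → Rel k
CycleEdge k i j = CycNext k i j ⊎ CycNext k j i

HasFreeOrientation : List OGraph → (n : ℕ) → Rel n → Set₁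
HasFreeOrientation F n E = Σ (Rel n) λ D → IsOrientationOf E D × Free F D

HasAcyclicFreeOrientation : List OGraph → (n : ℕ) → Rel n → Set₁
HasAcyclicFreeOrientation F n E =
  Σ (Rel n) λ D → IsOrientationOf E D × Acyclic D × Free F D

data Arrow : Set where
  left right : Arrow

Word : Set
Word = List Arrow

InL : (Word → Set) → Word → Set
InL A b = ∀ (c a d : Word) → b ≡ c ++ (a ++ d) → ¬ A a

pow : Word → ℕ → Word
pow a n = concat (replicate n a)

Periodic : (Word → Set) → ℕ → Word → Set
Periodic A k a = InL A a × length a ≡ k × (∀ (n : ℕ) → 1 ≤ n → InL A (pow a n))

Constant : Word → Set
Constant a = ∃ λ (s : Arrow) → All (_≡ s) a

{-# OPTIONS --safe #-}
module Submission where

-- A word of length k over {←,→} is an orientation of the path with k edges (letter i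
-- directs the edge {i, i+1}), so taking for A the words in which some H ∈ F occurs as an
-- induced subgraph gives (1). A word a of length K likewise orients the K-cycle. Once K
-- exceeds the order of every H ∈ F, and by two a bound on the walks joining vertices of H,
-- a copy of H in a power of a spans fewer than K - 1 consecutive positions and folds
-- injectively onto the cycle, while a copy in the cycle misses a vertex where the cycle can
-- be cut open into a factor of a²; this gives (2). For (3): an orientation of a cycle has a
-- directed cycle exactly when all its edges point the same way.

open import Defs
open import Data.Nat using (ℕ; zero; suc; pred; _+_; _*_; _∸_; _≤_; _<_; _≤?_; _<?_; z≤n; s≤s; _⊔_; ∣_-_∣; _%_; NonZero)
open import Data.Nat.Properties
open import Data.Nat.DivMod using (_/_; m%n<n; m%n%n≡m%n; m<n⇒m%n≡m; [m+n]%n≡m%n; m≡m%n+[m/n]*n; %-distribˡ-+; n%n≡0; m≤n⇒[n∸m]%m≡n%m)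
import Data.Fin as Fin
open import Data.Fin using (Fin; toℕ; fromℕ<; inject₁) renaming (zero to fzero; suc to fsuc)
open import Data.Fin.Properties using (toℕ-injective; toℕ-fromℕ<; toℕ-inject₁; toℕ<n; any?; all?; ¬∀⟶∃¬; injective⇒≤)
open import Data.List using (List; []; _∷_; _++_; length; tabulate)
open import Data.List.Properties using (length-++; ++-identityʳ; length-tabulate)
open import Data.List.Relation.Unary.All as All using (All; []; _∷_)
open import Data.Product using (Σ; ∃; _×_; _,_; proj₁; proj₂)
open import Data.Sum using (_⊎_; inj₁; inj₂)
open import Data.Empty using (⊥; ⊥-elim)
open import Relation.Nullary using (¬_; yes; no; contradiction)
open import Relation.Nullary.Decidable using (¬?; decidable-stable)
open import Relation.Binary.PropositionalEquality
open import Function.Bundles using (_⇔_; mk⇔; Equivalence)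
open import Function.Definitions using (Injective)
open import Function.Construct.Composition using (_⇔-∘_)
open import Function.Construct.Symmetry using (⇔-sym)

open Equivalence using (to; from)

-- Orientations given by labels

right≢left : right ≢ left
right≢left ()

direction : {A B : Set} → A ⊎ B → Arrow
direction (inj₁ _) = right
direction (inj₂ _) = left

Orient : {X : Set} → (X → X → Set) → (X → Arrow) → X → X → Set
Orient S g u v = (S u v × g u ≡ right) ⊎ (S v u × g v ≡ left)

module _ {X : Set} {S : X → X → Set} {g : X → Arrow} where

  Orient-irrefl : (∀ x → ¬ S x x) → ∀ x → ¬ Orient S g x x
  Orient-irrefl irr x (inj₁ (s , _)) = irr x s
  Orient-irrefl irr x (inj₂ (s , _)) = irr x s

  Orient-asym : (∀ x y → S x y → ¬ S y x) → ∀ x y → Orient S g x y → ¬ Orient S g y x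
  Orient-asym asym x y (inj₁ (s , _)) (inj₁ (s′ , _)) = asym x y s s′
  Orient-asym asym x y (inj₁ (_ , e)) (inj₂ (_ , e′)) = right≢left (trans (sym e) e′)
  Orient-asym asym x y (inj₂ (_ , e)) (inj₁ (_ , e′)) = right≢left (trans (sym e′) e)
  Orient-asym asym x y (inj₂ (s , _)) (inj₂ (s′ , _)) = asym x y s′ s

  Orient-edge : ∀ x y → (S x y ⊎ S y x) ⇔ (Orient S g x y ⊎ Orient S g y x)
  Orient-edge x y = mk⇔ orient forget
    where
    orient : S x y ⊎ S y x → Orient S g x y ⊎ Orient S g y x
    orient (inj₁ s) with g x
    ... | right = inj₁ (inj₁ (s , refl))
    ... | left  = inj₂ (inj₂ (s , refl))
    orient (inj₂ s) with g y
    ... | right = inj₂ (inj₁ (s , refl))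
    ... | left  = inj₁ (inj₂ (s , refl))
    forget : Orient S g x y ⊎ Orient S g y x → S x y ⊎ S y x
    forget (inj₁ (inj₁ (s , _))) = inj₁ s
    forget (inj₁ (inj₂ (s , _))) = inj₂ s
    forget (inj₂ (inj₁ (s , _))) = inj₂ s
    forget (inj₂ (inj₂ (s , _))) = inj₁ s

  orientation⇔Orient : (D : X → X → Set) → (∀ x y → D x y → ¬ D y x) →
    (∀ x y → D x y → S x y ⊎ S y x) →
    (∀ x y → S x y → Σ (D x y ⊎ D y x) λ d → g x ≡ direction d) →
    ∀ x y → D x y ⇔ Orient S g x y
  orientation⇔Orient D asym edge label x y = mk⇔ toOrient fromOrient
    where
    toOrient : D x y → Orient S g x y
    toOrient d with edge x y d
    ... | inj₁ s with label x y s
    ...   | inj₁ _ , e = inj₁ (s , e)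
    ...   | inj₂ d′ , _ = contradiction d′ (asym x y d)
    toOrient d | inj₂ s with label y x s
    ...   | inj₁ d′ , _ = contradiction d′ (asym x y d)
    ...   | inj₂ _ , e = inj₂ (s , e)
    fromOrient : Orient S g x y → D x y
    fromOrient (inj₁ (s , e)) with label x y s
    ... | inj₁ d , _ = d
    ... | inj₂ _ , e′ = ⊥-elim (right≢left (trans (sym e) e′))
    fromOrient (inj₂ (s , e)) with label y x s
    ... | inj₂ d , _ = d
    ... | inj₁ _ , e′ = ⊥-elim (right≢left (trans (sym e′) e))

Orient-cong : ∀ {X Y : Set} {S : X → X → Set} {S′ : Y → Y → Set} {g : X → Arrow} {g′ : Y → Arrow}
  {x y : X} {x′ y′ : Y} → S x y ⇔ S′ x′ y′ → S y x ⇔ S′ y′ x′ →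
  (S x y → g′ x′ ≡ g x) → (S y x → g′ y′ ≡ g y) →
  Orient S g x y ⇔ Orient S′ g′ x′ y′
Orient-cong Sxy Syx gx gy = mk⇔
  (λ { (inj₁ (s , e)) → inj₁ (to Sxy s , trans (gx s) e)
     ; (inj₂ (s , e)) → inj₂ (to Syx s , trans (gy s) e) })
  (λ { (inj₁ (s , e)) → inj₁ (from Sxy s , trans (sym (gx (from Sxy s))) e)
     ; (inj₂ (s , e)) → inj₂ (from Syx s , trans (sym (gy (from Syx s))) e) })

Orient-isOrientationOf : ∀ {n} {S : Rel n} (g : Fin n → Arrow) →
  (∀ x → ¬ S x x) → (∀ x y → S x y → ¬ S y x) →
  IsOrientationOf (λ x y → S x y ⊎ S y x) (Orient S g)
Orient-isOrientationOf {S = S} g irr asym =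
  (Orient-irrefl {S = S} {g} irr , Orient-asym {S = S} {g} asym) , Orient-edge {S = S} {g}

InducedIn-resp : ∀ {H n} {D D′ : Rel n} → (∀ x y → D x y ⇔ D′ x y) → InducedIn H D → InducedIn H D′
InducedIn-resp D⇔D′ (f , inj , arcs) = f , inj , λ x y → D⇔D′ (f x) (f y) ⇔-∘ arcs x y

-- Words as path orientations

-- Positions past the end of a word read as ←; occurrences only inspect letters inside the word.
letter : Word → ℕ → Arrow
letter []      _       = left
letter (x ∷ w) zero    = x
letter (x ∷ w) (suc i) = letter w i

letter-++ˡ : ∀ a b {i} → i < length a → letter (a ++ b) i ≡ letter a i
letter-++ˡ (x ∷ a) b {zero}  _         = refl
letter-++ˡ (x ∷ a) b {suc i} (s≤s i<a) = letter-++ˡ a b i<a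

letter-++ʳ : ∀ a b i → letter (a ++ b) (length a + i) ≡ letter b i
letter-++ʳ []      b i = refl
letter-++ʳ (x ∷ a) b i = letter-++ʳ a b i

letter-tabulate : ∀ {k} (f : Fin k → Arrow) i → letter (tabulate f) (toℕ i) ≡ f i
letter-tabulate f fzero    = refl
letter-tabulate f (fsuc i) = letter-tabulate (λ j → f (fsuc j)) i

Step : ℕ → ℕ → Set
Step i j = j ≡ suc i

PathArc : Word → ℕ → ℕ → Set
PathArc w = Orient Step (letter w)

OccursIn : OGraph → Word → Set
OccursIn H w = Σ (Fin (size H) → ℕ) λ p →
  Injective _≡_ _≡_ p × (∀ x → p x ≤ length w) × (∀ x y → arc H x y ⇔ PathArc w (p x) (p y))

Forbidden : List OGraph → Word → Set
Forbidden []      w = ⊥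
Forbidden (H ∷ F) w = OccursIn H w ⊎ Forbidden F w

PathArc-infix : ∀ c b d {i j} → i ≤ length b → j ≤ length b →
  PathArc b i j ⇔ PathArc (c ++ b ++ d) (length c + i) (length c + j)
PathArc-infix c b d {i} {j} i≤b j≤b =
  Orient-cong {S = Step} {S′ = Step} {g = letter b} {g′ = letter (c ++ b ++ d)}
    (shift i j) (shift j i) (inner i j≤b) (inner j i≤b)
  where
  shift : ∀ i j → j ≡ suc i ⇔ length c + j ≡ suc (length c + i)
  shift i j = mk⇔ (λ e → trans (cong (length c +_) e) (+-suc (length c) i))
                  (λ e → +-cancelˡ-≡ (length c) j (suc i) (trans e (sym (+-suc (length c) i))))
  inner : ∀ i {j} → j ≤ length b → j ≡ suc i → letter (c ++ b ++ d) (length c + i) ≡ letter b i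
  inner i j≤b refl = trans (letter-++ʳ c (b ++ d) i) (letter-++ˡ b d j≤b)

occurs-infix : ∀ {H} c b d → OccursIn H b → OccursIn H (c ++ b ++ d)
occurs-infix c b d (p , p-inj , p≤b , arcs) =
  (λ x → length c + p x) ,
  (λ e → p-inj (+-cancelˡ-≡ (length c) _ _ e)) ,
  (λ x → subst (length c + p x ≤_) (sym (length-infix))
            (+-monoʳ-≤ (length c) (≤-trans (p≤b x) (m≤m+n (length b) (length d))))) ,
  (λ x y → PathArc-infix c b d (p≤b x) (p≤b y) ⇔-∘ arcs x y)
  where
  length-infix : length (c ++ b ++ d) ≡ length c + (length b + length d)
  length-infix = trans (length-++ c) (cong (length c +_) (length-++ b))

forbidden-infix : ∀ F c b d → Forbidden F b → Forbidden F (c ++ b ++ d)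
forbidden-infix (H ∷ F) c b d (inj₁ occ) = inj₁ (occurs-infix {H} c b d occ)
forbidden-infix (H ∷ F) c b d (inj₂ fb)  = inj₂ (forbidden-infix F c b d fb)

¬forbidden⇒InL : ∀ F w → ¬ Forbidden F w → InL (Forbidden F) w
¬forbidden⇒InL F w ¬fw c b d refl fb = ¬fw (forbidden-infix F c b d fb)

InL⇒¬ : ∀ {A : Word → Set} {w} → InL A w → ¬ A w
InL⇒¬ {w = w} inL = inL [] w [] (sym (++-identityʳ w))

module _ {n} {D : Rel n} where

  free⇒¬forbidden : ∀ F w → All (λ H → OccursIn H w → InducedIn H D) F → Free F D → ¬ Forbidden F w
  free⇒¬forbidden (H ∷ F) w (induce ∷ _) (¬ind ∷ _) (inj₁ occ) = ¬ind (induce occ)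
  free⇒¬forbidden (H ∷ F) w (_ ∷ induce) (_ ∷ free) (inj₂ fb) = free⇒¬forbidden F w induce free fb

  ¬forbidden⇒free : ∀ F w → All (λ H → InducedIn H D → OccursIn H w) F → ¬ Forbidden F w → Free F D
  ¬forbidden⇒free []      w []               _   = []
  ¬forbidden⇒free (H ∷ F) w (occur ∷ occurs) ¬fw =
    (λ ind → ¬fw (inj₁ (occur ind))) ∷ ¬forbidden⇒free F w occurs (λ fb → ¬fw (inj₂ fb))

PathOrientation : (k : ℕ) → Word → Rel (suc k)
PathOrientation k w x y = PathArc w (toℕ x) (toℕ y)

PathOrientation-isOrientation : ∀ k w → IsOrientationOf (PathEdge k) (PathOrientation k w)
PathOrientation-isOrientation k w =
  Orient-isOrientationOf {S = λ x y → Step (toℕ x) (toℕ y)} (λ x → letter w (toℕ x))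
    (λ x e → 1+n≢n (sym e))
    (λ x y y=1+x x=1+y → m+1+n≢n 1 (sym (trans x=1+y (cong suc y=1+x))))

occurs⇔induced : ∀ {H k} w → length w ≡ k → OccursIn H w ⇔ InducedIn H (PathOrientation k w)
occurs⇔induced {H} {k} w refl = mk⇔ induce occur
  where
  induce : OccursIn H w → InducedIn H (PathOrientation k w)
  induce (p , p-inj , p≤k , arcs) = f , f-inj , f-arcs
    where
    f : Fin (size H) → Fin (suc k)
    f x = fromℕ< (s≤s (p≤k x))
    toℕ-f : ∀ x → toℕ (f x) ≡ p x
    toℕ-f x = toℕ-fromℕ< (s≤s (p≤k x))
    f-inj : Injective _≡_ _≡_ f
    f-inj {x} {y} e = p-inj (trans (sym (toℕ-f x)) (trans (cong toℕ e) (toℕ-f y)))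
    f-arcs : ∀ x y → arc H x y ⇔ PathOrientation k w (f x) (f y)
    f-arcs x y = subst₂ (λ i j → arc H x y ⇔ PathArc w i j) (sym (toℕ-f x)) (sym (toℕ-f y)) (arcs x y)
  occur : InducedIn H (PathOrientation k w) → OccursIn H w
  occur (f , f-inj , arcs) =
    (λ x → toℕ (f x)) , (λ e → f-inj (toℕ-injective e)) , (λ x → ≤-pred (toℕ<n (f x))) , arcs

successor-view : ∀ {k} (x y : Fin (suc k)) → toℕ y ≡ suc (toℕ x) →
  ∃ λ (i : Fin k) → inject₁ i ≡ x × fsuc i ≡ y
successor-view {suc k} fzero    (fsuc fzero) refl = fzero , refl , refl
successor-view {suc k} (fsuc x) (fsuc y)     e    with successor-view x y (suc-injective e)
... | i , refl , refl = fsuc i , refl , refl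

module PathWord {k} (D : Rel (suc k)) (D-orient : IsOrientationOf (PathEdge k) D) where

  edge : ∀ x y → Step (toℕ x) (toℕ y) → D x y ⊎ D y x
  edge x y s = to (proj₂ D-orient x y) (inj₁ s)

  word : Word
  word = tabulate λ i → direction (edge (inject₁ i) (fsuc i) (cong suc (sym (toℕ-inject₁ i))))

  word-length : length word ≡ k
  word-length = length-tabulate _

  labelled : ∀ x y → Step (toℕ x) (toℕ y) →
    Σ (D x y ⊎ D y x) λ d → letter word (toℕ x) ≡ direction d
  labelled x y s with successor-view x y s
  ... | i , refl , refl = _ , trans (cong (letter word) (toℕ-inject₁ i)) (letter-tabulate _ i)

  D⇔PathOrientation : ∀ x y → D x y ⇔ PathOrientation k word x y
  D⇔PathOrientation = orientation⇔Orient D (proj₂ (proj₁ D-orient))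
    (λ x y d → from (proj₂ D-orient x y) (inj₁ d)) labelled

path-orientation⇔word : ∀ F k →
  HasFreeOrientation F (suc k) (PathEdge k) ⇔ (∃ λ w → length w ≡ k × InL (Forbidden F) w)
path-orientation⇔word F k = mk⇔ toWord fromWord
  where
  toWord : HasFreeOrientation F (suc k) (PathEdge k) → ∃ λ w → length w ≡ k × InL (Forbidden F) w
  toWord (D , D-orient , free) = word , word-length ,
    ¬forbidden⇒InL F word (free⇒¬forbidden {D = D} F word (All.universal induce F) free)
    where
    open PathWord D D-orient
    induce : ∀ H → OccursIn H word → InducedIn H D
    induce H occ = InducedIn-resp {H} (λ x y → ⇔-sym (D⇔PathOrientation x y))
      (to (occurs⇔induced {H} word word-length) occ)
  fromWord : (∃ λ w → length w ≡ k × InL (Forbidden F) w) → HasFreeOrientation F (suc k) (PathEdge k)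
  fromWord (w , refl , inL) = PathOrientation k w , PathOrientation-isOrientation k w ,
    ¬forbidden⇒free {D = PathOrientation k w} F w
      (All.universal (λ H → from (occurs⇔induced {H} w refl)) F) (InL⇒¬ inL)

-- Connected graphs have bounded placements

walkLength : ∀ {n} {R : Rel n} {x y} → UReach R x y → ℕ
walkLength here       = 0
walkLength (step _ w) = suc (walkLength w)

UnitSteps : ∀ {n} → Rel n → (Fin n → ℕ) → Set
UnitSteps R p = ∀ x y → R x y → ∣ p x - p y ∣ ≡ 1

∣-∣≤walkLength : ∀ {n} {R : Rel n} p → UnitSteps R p → ∀ {x y} (w : UReach R x y) → ∣ p x - p y ∣ ≤ walkLength w
∣-∣≤walkLength p unit {x} here = ≤-reflexive (∣n-n∣≡0 (p x))
∣-∣≤walkLength p unit {x} {z} (step {y = y} r w) = begin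
  ∣ p x - p z ∣                  ≤⟨ ∣-∣-triangle (p x) (p y) (p z) ⟩
  ∣ p x - p y ∣ + ∣ p y - p z ∣  ≡⟨ cong (_+ ∣ p y - p z ∣) (one-step r) ⟩
  suc ∣ p y - p z ∣             ≤⟨ s≤s (∣-∣≤walkLength p unit w) ⟩
  suc (walkLength w)            ∎
  where
  open ≤-Reasoning
  one-step : _ ⊎ _ → ∣ p x - p y ∣ ≡ 1
  one-step (inj₁ rxy) = unit x y rxy
  one-step (inj₂ ryx) = trans (∣-∣-comm (p x) (p y)) (unit y x ryx)

-- The two conditions let induced copies of H pass between the K-cycle and the powers of its word.
Fits : ℕ → OGraph → Set
Fits K H = size H < K × (∀ p → UnitSteps (arc H) p → ∀ x y → suc ∣ p x - p y ∣ < K)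

Fits-mono : ∀ {K K′ H} → K ≤ K′ → Fits K H → Fits K′ H
Fits-mono K≤K′ (small , narrow) = ≤-trans small K≤K′ , λ p unit x y → ≤-trans (narrow p unit x y) K≤K′

upper-bound : ∀ {n} (f : Fin n → ℕ) → ∃ λ b → ∀ i → f i ≤ b
upper-bound {zero}  f = 0 , λ ()
upper-bound {suc n} f with upper-bound (λ i → f (fsuc i))
... | b , f≤b = f fzero ⊔ b , λ { fzero → m≤m⊔n (f fzero) b ; (fsuc i) → ≤-trans (f≤b i) (m≤n⊔m (f fzero) b) }

connected⇒fits : ∀ {H} → Connected H → ∃ λ K → Fits K H
connected⇒fits {H} conn = suc (suc (size H + bound)) , small , narrow
  where
  furthest : Fin (size H) → ℕ
  furthest x = proj₁ (upper-bound λ y → walkLength (conn x y))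
  bound : ℕ
  bound = proj₁ (upper-bound furthest)
  walk≤bound : ∀ x y → walkLength (conn x y) ≤ bound
  walk≤bound x y = ≤-trans (proj₂ (upper-bound λ y → walkLength (conn x y)) y) (proj₂ (upper-bound furthest) x)
  small : size H < suc (suc (size H + bound))
  small = s≤s (≤-trans (m≤m+n (size H) bound) (n≤1+n _))
  narrow : ∀ p → UnitSteps (arc H) p → ∀ x y → suc ∣ p x - p y ∣ < suc (suc (size H + bound))
  narrow p unit x y = s≤s (s≤s (≤-trans (∣-∣≤walkLength p unit (conn x y))
                                        (≤-trans (walk≤bound x y) (m≤n+m bound (size H)))))

common-fit : ∀ F → All (λ H → ∃ λ K → Fits K H) F → ∃ λ m → All (Fits m) F
common-fit []      []                = 0 , []
common-fit (H ∷ F) ((K , fits) ∷ rest) with common-fit F rest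
... | m , fit-m = K ⊔ m , Fits-mono {H = H} (m≤m⊔n K m) fits ∷ All.map (λ {H′} → Fits-mono {H = H′} (m≤n⊔m K m)) fit-m

-- Cycles

∣n-1+n∣≡1 : ∀ n → ∣ n - suc n ∣ ≡ 1
∣n-1+n∣≡1 zero    = refl
∣n-1+n∣≡1 (suc n) = ∣n-1+n∣≡1 n

∣1+m-n∣≤1+∣m-n∣ : ∀ m n → ∣ suc m - n ∣ ≤ suc ∣ m - n ∣
∣1+m-n∣≤1+∣m-n∣ zero    zero    = ≤-refl
∣1+m-n∣≤1+∣m-n∣ zero    (suc n) = ≤-trans (n≤1+n n) (n≤1+n (suc n))
∣1+m-n∣≤1+∣m-n∣ (suc m) zero    = ≤-refl
∣1+m-n∣≤1+∣m-n∣ (suc m) (suc n) = ∣1+m-n∣≤1+∣m-n∣ m n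

PathArc⇒∣-∣≡1 : ∀ w i j → PathArc w i j → ∣ i - j ∣ ≡ 1
PathArc⇒∣-∣≡1 w i _ (inj₁ (refl , _)) = ∣n-1+n∣≡1 i
PathArc⇒∣-∣≡1 w _ j (inj₂ (refl , _)) = trans (∣-∣-comm (suc j) j) (∣n-1+n∣≡1 j)

suc[∸]<-window : ∀ {K z x y} → x ≤ y → z < x → y < z + K → suc (y ∸ x) < K
suc[∸]<-window {K} {z} {x} {y} x≤y z<x y<z+K = +-cancelˡ-≤ z _ _ (begin
  z + suc (suc (y ∸ x))  ≡⟨ +-suc z (suc (y ∸ x)) ⟩
  suc z + suc (y ∸ x)    ≤⟨ +-monoˡ-≤ (suc (y ∸ x)) z<x ⟩
  x + suc (y ∸ x)        ≡⟨ +-suc x (y ∸ x) ⟩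
  suc (x + (y ∸ x))      ≡⟨ cong suc (m+[n∸m]≡n x≤y) ⟩
  suc y                  ≤⟨ y<z+K ⟩
  z + K                  ∎)
  where open ≤-Reasoning

suc∣-∣<-window : ∀ {K z x y} → z < x → x < z + K → z < y → y < z + K → suc ∣ x - y ∣ < K
suc∣-∣<-window {K} {z} {x} {y} z<x x<z+K z<y y<z+K with ≤-total x y
... | inj₁ x≤y = subst (λ d → suc d < K) (sym (m≤n⇒∣m-n∣≡n∸m x≤y)) (suc[∸]<-window x≤y z<x y<z+K)
... | inj₂ y≤x = subst (λ d → suc d < K) (sym (m≤n⇒∣n-m∣≡n∸m y≤x)) (suc[∸]<-window y≤x z<y x<z+K)

missed-by-injection : ∀ {s K} (f : Fin s → Fin K) → Injective _≡_ _≡_ f → s < K → ∃ λ z → ∀ x → f x ≢ z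
missed-by-injection {s} {K} f f-inj s<K with any? (λ z → all? (λ x → ¬? (f x Fin.≟ z)))
... | yes missed = missed
... | no ¬missed = contradiction (injective⇒≤ {f = preimage} preimage-inj) (<⇒≱ s<K)
  where
  hit : ∀ z → ∃ λ x → f x ≡ z
  hit z with ¬∀⟶∃¬ s (λ x → f x ≢ z) (λ x → ¬? (f x Fin.≟ z)) (λ all → ¬missed (z , all))
  ... | x , ¬≢ = x , decidable-stable (f x Fin.≟ z) ¬≢
  preimage : Fin K → Fin s
  preimage z = proj₁ (hit z)
  preimage-inj : Injective _≡_ _≡_ preimage
  preimage-inj {z} {z′} e = trans (sym (proj₂ (hit z))) (trans (cong f e) (proj₂ (hit z′)))

module _ {n} {R : Rel n} where

  DWalk-snoc : ∀ {x y z} → DWalk R x y → R y z → DWalk R x z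
  DWalk-snoc (one r)    r′ = more r (one r′)
  DWalk-snoc (more r w) r′ = more r (DWalk-snoc w r′)

  DWalk-reverse : ∀ {x y} → DWalk (λ u v → R v u) x y → DWalk R y x
  DWalk-reverse (one r)    = one r
  DWalk-reverse (more r w) = DWalk-snoc (DWalk-reverse w) r

  Acyclic-resp : ∀ {R′ : Rel n} → (∀ {u v} → R u v → R′ u v) → Acyclic R′ → Acyclic R
  Acyclic-resp {R′} R⊆R′ acyclic x w = acyclic x (map-walk w)
    where
    map-walk : ∀ {x y} → DWalk R x y → DWalk R′ x y
    map-walk (one r)    = one (R⊆R′ r)
    map-walk (more r w) = more (R⊆R′ r) (map-walk w)

letter-All : ∀ {s} a → All (_≡ s) a → ∀ {i} → i < length a → letter a i ≡ s
letter-All (x ∷ a) (x≡s ∷ _)  {zero}  _         = x≡s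
letter-All (x ∷ a) (_ ∷ all) {suc i} (s≤s i<a) = letter-All a all i<a

opposite : Arrow → Arrow
opposite left  = right
opposite right = left

opposite-dichotomy : ∀ s x → x ≡ s ⊎ x ≡ opposite s
opposite-dichotomy left  left  = inj₁ refl
opposite-dichotomy left  right = inj₂ refl
opposite-dichotomy right left  = inj₂ refl
opposite-dichotomy right right = inj₁ refl

letter-search : ∀ s a → (∃ λ i → i < length a × letter a i ≡ s) ⊎ All (_≡ opposite s) a
letter-search s []      = inj₂ []
letter-search s (x ∷ a) with opposite-dichotomy s x | letter-search s a
... | inj₁ x≡s  | _                  = inj₁ (0 , s≤s z≤n , x≡s)
... | inj₂ x≡opp | inj₁ (i , i<a , e) = inj₁ (suc i , s≤s i<a , e)
... | inj₂ x≡opp | inj₂ all           = inj₂ (x≡opp ∷ all)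

nonconstant⇒letter : ∀ {a} → ¬ Constant a → ∀ s → ∃ λ i → i < length a × letter a i ≡ s
nonconstant⇒letter {a} ¬const s with letter-search s a
... | inj₁ found = found
... | inj₂ all   = contradiction (opposite s , all) ¬const

module Cycle (K : ℕ) {{_ : NonZero K}} where

  CycStep : ℕ → ℕ → Set
  CycStep i j = Step i j ⊎ (suc i ≡ K × j ≡ 0)

  CycArc : Word → ℕ → ℕ → Set
  CycArc a = Orient CycStep (letter a)

  suc-% : ∀ i → suc i % K ≡ suc (i % K) % K
  suc-% i = begin
    suc i % K                   ≡⟨ %-distribˡ-+ 1 i K ⟩
    (1 % K + i % K) % K         ≡⟨ cong (λ r → (1 % K + r) % K) (sym (m%n%n≡m%n i K)) ⟩
    (1 % K + i % K % K) % K     ≡⟨ sym (%-distribˡ-+ 1 (i % K) K) ⟩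
    suc (i % K) % K             ∎
    where open ≡-Reasoning

  CycStep-% : ∀ i → CycStep (i % K) (suc i % K)
  CycStep-% i with m≤n⇒m<n∨m≡n (m%n<n i K)
  ... | inj₁ lt = inj₁ (trans (suc-% i) (m<n⇒m%n≡m lt))
  ... | inj₂ eq = inj₂ (eq , trans (suc-% i) (trans (cong (_% K) eq) (n%n≡0 K)))

  CycStep-functional : ∀ {i j j′} → j < K → j′ < K → CycStep i j → CycStep i j′ → j ≡ j′
  CycStep-functional _   _    (inj₁ e)       (inj₁ e′)       = trans e (sym e′)
  CycStep-functional j<K _    (inj₁ e)       (inj₂ (s , _))  = contradiction (trans e s) (<⇒≢ j<K)
  CycStep-functional _   j′<K (inj₂ (s , _)) (inj₁ e′)       = contradiction (trans e′ s) (<⇒≢ j′<K)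
  CycStep-functional _   _    (inj₂ (_ , e)) (inj₂ (_ , e′)) = trans e (sym e′)

  CycStep-injective : ∀ {i i′ j} → CycStep i j → CycStep i′ j → i ≡ i′
  CycStep-injective (inj₁ e)       (inj₁ e′)       = suc-injective (trans (sym e) e′)
  CycStep-injective (inj₁ e)       (inj₂ (_ , z))  = contradiction (trans (sym e) z) λ ()
  CycStep-injective (inj₂ (_ , z)) (inj₁ e′)       = contradiction (trans (sym e′) z) λ ()
  CycStep-injective (inj₂ (s , _)) (inj₂ (s′ , _)) = suc-injective (trans s (sym s′))

  ∸≡multiple : ∀ {i j} → i % K ≡ j % K → j ∸ i ≡ (j / K ∸ i / K) * K
  ∸≡multiple {i} {j} eq = begin
    j ∸ i                                      ≡⟨ cong₂ _∸_ (m≡m%n+[m/n]*n j K) (m≡m%n+[m/n]*n i K) ⟩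
    (j % K + j / K * K) ∸ (i % K + i / K * K)  ≡⟨ cong (λ r → (r + j / K * K) ∸ (i % K + i / K * K)) (sym eq) ⟩
    (i % K + j / K * K) ∸ (i % K + i / K * K)  ≡⟨ [m+n]∸[m+o]≡n∸o (i % K) _ _ ⟩
    j / K * K ∸ i / K * K                      ≡⟨ sym (*-distribʳ-∸ K (j / K) (i / K)) ⟩
    (j / K ∸ i / K) * K                        ∎
    where open ≡-Reasoning

  multiple<⇒≡0 : ∀ {n} q → n ≡ q * K → n < K → n ≡ 0
  multiple<⇒≡0 zero    n≡0    _   = n≡0
  multiple<⇒≡0 (suc q) n≡K+qK n<K = contradiction (subst (K ≤_) (sym n≡K+qK) (m≤m+n K (q * K))) (<⇒≱ n<K)

  %-injective-near : ∀ {i j} → i % K ≡ j % K → ∣ i - j ∣ < K → i ≡ j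
  %-injective-near {i} {j} eq near with ≤-total i j
  ... | inj₁ i≤j = ≤-antisym i≤j (m∸n≡0⇒m≤n (multiple<⇒≡0 (j / K ∸ i / K) (∸≡multiple eq)
                                                (subst (_< K) (m≤n⇒∣m-n∣≡n∸m i≤j) near)))
  ... | inj₂ j≤i = ≤-antisym (m∸n≡0⇒m≤n (multiple<⇒≡0 (i / K ∸ j / K) (∸≡multiple (sym eq))
                                          (subst (_< K) (m≤n⇒∣n-m∣≡n∸m j≤i) near))) j≤i

  length-pow : ∀ a → length a ≡ K → ∀ n → length (pow a n) ≡ n * K
  length-pow a a-len zero    = refl
  length-pow a a-len (suc n) = trans (length-++ a) (cong₂ _+_ a-len (length-pow a a-len n))

  letter-pow : ∀ a → length a ≡ K → ∀ n {i} → i < n * K → letter (pow a n) i ≡ letter a (i % K)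
  letter-pow a refl (suc n) {i} i<nK with i <? length a
  ... | yes i<K = trans (letter-++ˡ a (pow a n) i<K) (cong (letter a) (sym (m<n⇒m%n≡m i<K)))
  ... | no i≮K = begin
    letter (a ++ pow a n) i                ≡⟨ cong (letter (a ++ pow a n)) (sym (m+[n∸m]≡n K≤i)) ⟩
    letter (a ++ pow a n) (K + (i ∸ K))    ≡⟨ letter-++ʳ a (pow a n) (i ∸ K) ⟩
    letter (pow a n) (i ∸ K)               ≡⟨ letter-pow a refl n i∸K<nK ⟩
    letter a ((i ∸ K) % K)                 ≡⟨ cong (letter a) (m≤n⇒[n∸m]%m≡n%m K≤i) ⟩
    letter a (i % K)                       ∎
    where
    open ≡-Reasoning
    K≤i : length a ≤ i
    K≤i = ≮⇒≥ i≮K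
    i∸K<nK : i ∸ length a < n * length a
    i∸K<nK = subst (i ∸ length a <_) (m+n∸m≡n (length a) (n * length a)) (∸-monoˡ-< i<nK K≤i)

  unroll : ∀ a → length a ≡ K → ∀ n {i j} → i ≤ n * K → j ≤ n * K → suc ∣ i - j ∣ < K →
    PathArc (pow a n) i j ⇔ CycArc a (i % K) (j % K)
  unroll a a-len n {i} {j} i≤nK j≤nK near =
    Orient-cong {S = Step} {S′ = CycStep} {g = letter (pow a n)} {g′ = letter a}
      (wrap near) (wrap (subst (λ d → suc d < K) (∣-∣-comm i j) near)) (unwrapped j≤nK) (unwrapped i≤nK)
    where
    wrap : ∀ {i j} → suc ∣ i - j ∣ < K → Step i j ⇔ CycStep (i % K) (j % K)
    wrap {i} {j} near = mk⇔ (λ { refl → CycStep-% i })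
      (λ s → sym (%-injective-near (CycStep-functional (m%n<n (suc i) K) (m%n<n j K) (CycStep-% i) s)
                                    (≤-<-trans (∣1+m-n∣≤1+∣m-n∣ i j) near)))
    unwrapped : ∀ {i j} → j ≤ n * K → Step i j → letter a (i % K) ≡ letter (pow a n) i
    unwrapped j≤nK refl = sym (letter-pow a a-len n j≤nK)

  fin% : ℕ → Fin K
  fin% i = fromℕ< (m%n<n i K)

  toℕ-fin% : ∀ i → toℕ (fin% i) ≡ i % K
  toℕ-fin% i = toℕ-fromℕ< (m%n<n i K)

  -- Read around the cycle starting just after z, position t (< K) comes at unwind z t.
  unwind : ℕ → ℕ → ℕ
  unwind z t with t ≤? z
  ... | yes _ = t + K
  ... | no  _ = t

  unwind-% : ∀ z {t} → t < K → unwind z t % K ≡ t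
  unwind-% z {t} t<K with t ≤? z
  ... | yes _ = trans ([m+n]%n≡m%n t K) (m<n⇒m%n≡m t<K)
  ... | no  _ = m<n⇒m%n≡m t<K

  unwind-window : ∀ {z t} → z < K → t < K → t ≢ z → z < unwind z t × unwind z t < z + K
  unwind-window {z} {t} z<K t<K t≢z with t ≤? z
  ... | yes t≤z = <-≤-trans z<K (m≤n+m K t) , +-monoˡ-< K (≤∧≢⇒< t≤z t≢z)
  ... | no  t≰z = ≰⇒> t≰z , <-≤-trans t<K (m≤n+m K z)

  unwind-rises : ∀ {z t t′} → z < K → t ≢ z → CycStep t t′ → unwind z t < unwind z t′
  unwind-rises {z} {t} {t′} z<K t≢z s with t ≤? z | t′ ≤? z | s
  ... | yes _   | yes _    | inj₁ refl           = ≤-refl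
  ... | yes t≤z | no  t′≰z | inj₁ refl           = contradiction (≤-antisym t≤z (≤-pred (≰⇒> t′≰z))) t≢z
  ... | no  t≰z | yes t′≤z | inj₁ refl           = contradiction (≤-trans (n≤1+n t) t′≤z) t≰z
  ... | no  _   | no  _    | inj₁ refl           = ≤-refl
  ... | yes t≤z | _        | inj₂ (t+1≡K , _)    =
    contradiction (≤-antisym t≤z (≤-pred (subst (z <_) (sym t+1≡K) z<K))) t≢z
  ... | no  _   | yes _    | inj₂ (t+1≡K , refl) = subst (t <_) t+1≡K ≤-refl
  ... | no  _   | no  0≰z  | inj₂ (_ , refl)     = contradiction z≤n 0≰z

  CycStep-irrefl : 1 < K → ∀ {i} → ¬ CycStep i i
  CycStep-irrefl _   (inj₁ e)            = 1+n≢n (sym e)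
  CycStep-irrefl 1<K (inj₂ (1≡K , refl)) = <⇒≢ 1<K 1≡K

  CycStep-asym : 2 < K → ∀ {i j} → CycStep i j → ¬ CycStep j i
  CycStep-asym _   (inj₁ refl)         (inj₁ e)            = m+1+n≢n 1 (sym e)
  CycStep-asym 2<K (inj₁ refl)         (inj₂ (2≡K , refl)) = <⇒≢ 2<K 2≡K
  CycStep-asym 2<K (inj₂ (2≡K , refl)) (inj₁ refl)         = <⇒≢ 2<K 2≡K
  CycStep-asym 2<K (inj₂ (1≡K , refl)) (inj₂ (_ , refl))   = <⇒≢ (<-trans (n<1+n 1) 2<K) 1≡K

  CycleOrientation : Word → Rel K
  CycleOrientation a u v = CycArc a (toℕ u) (toℕ v)

  CycleOrientation-isOrientation : 2 < K → ∀ a → IsOrientationOf (CycleEdge K) (CycleOrientation a)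
  CycleOrientation-isOrientation 2<K a =
    Orient-isOrientationOf {S = CycNext K} (λ u → letter a (toℕ u))
      (λ _ → CycStep-irrefl (<-trans (n<1+n 1) 2<K)) (λ _ _ → CycStep-asym 2<K)

  occurs-pow⇒induced : ∀ a {H} → length a ≡ K → Fits K H → ∀ n →
    OccursIn H (pow a n) → InducedIn H (CycleOrientation a)
  occurs-pow⇒induced a {H} a-len (_ , narrow) n (p , p-inj , p≤ , arcs) = r , r-inj , r-arcs
    where
    p≤nK : ∀ x → p x ≤ n * K
    p≤nK x = subst (p x ≤_) (length-pow a a-len n) (p≤ x)
    near : ∀ x y → suc ∣ p x - p y ∣ < K
    near = narrow p (λ x y h → PathArc⇒∣-∣≡1 (pow a n) (p x) (p y) (to (arcs x y) h))
    r : Fin (size H) → Fin K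
    r x = fin% (p x)
    r-inj : Injective _≡_ _≡_ r
    r-inj {x} {y} e = p-inj (%-injective-near (trans (sym (toℕ-fin% (p x))) (trans (cong toℕ e) (toℕ-fin% (p y))))
                                               (<⇒≤ (near x y)))
    r-arcs : ∀ x y → arc H x y ⇔ CycleOrientation a (r x) (r y)
    r-arcs x y = subst₂ (λ i j → arc H x y ⇔ CycArc a i j) (sym (toℕ-fin% (p x))) (sym (toℕ-fin% (p y)))
                   (unroll a a-len n (p≤nK x) (p≤nK y) (near x y) ⇔-∘ arcs x y)

  induced⇒occurs-pow2 : ∀ a {H} → length a ≡ K → Fits K H →
    InducedIn H (CycleOrientation a) → OccursIn H (pow a 2)
  induced⇒occurs-pow2 a {H} a-len (small , _) (f , f-inj , arcs) = p , p-inj , p≤ , p-arcs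
    where
    z : Fin K
    z = proj₁ (missed-by-injection f f-inj small)
    f≢z : ∀ x → toℕ (f x) ≢ toℕ z
    f≢z x e = proj₂ (missed-by-injection f f-inj small) x (toℕ-injective e)
    p : Fin (size H) → ℕ
    p x = unwind (toℕ z) (toℕ (f x))
    p%K : ∀ x → p x % K ≡ toℕ (f x)
    p%K x = unwind-% (toℕ z) (toℕ<n (f x))
    window : ∀ x → toℕ z < p x × p x < toℕ z + K
    window x = unwind-window (toℕ<n z) (toℕ<n (f x)) (f≢z x)
    p≤2K : ∀ x → p x ≤ 2 * K
    p≤2K x = ≤-trans (<⇒≤ (proj₂ (window x)))
      (≤-trans (+-monoˡ-≤ K (<⇒≤ (toℕ<n z))) (≤-reflexive (cong (K +_) (sym (+-identityʳ K)))))
    p-inj : Injective _≡_ _≡_ p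
    p-inj {x} {y} e = f-inj (toℕ-injective (trans (sym (p%K x)) (trans (cong (_% K) e) (p%K y))))
    p≤ : ∀ x → p x ≤ length (pow a 2)
    p≤ x = subst (p x ≤_) (sym (length-pow a a-len 2)) (p≤2K x)
    p-arcs : ∀ x y → arc H x y ⇔ PathArc (pow a 2) (p x) (p y)
    p-arcs x y = ⇔-sym (unroll a a-len 2 (p≤2K x) (p≤2K y)
                          (suc∣-∣<-window (proj₁ (window x)) (proj₂ (window x)) (proj₁ (window y)) (proj₂ (window y))))
                 ⇔-∘ subst₂ (λ i j → arc H x y ⇔ CycArc a i j) (sym (p%K x)) (sym (p%K y)) (arcs x y)

  next : Fin K → Fin K
  next u = fin% (suc (toℕ u))

  CycStep-next : ∀ u → CycStep (toℕ u) (toℕ (next u))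
  CycStep-next u = subst₂ CycStep (m<n⇒m%n≡m (toℕ<n u)) (sym (toℕ-fin% (suc (toℕ u)))) (CycStep-% (toℕ u))

  next-unique : ∀ {u v} → CycStep (toℕ u) (toℕ v) → v ≡ next u
  next-unique {u} {v} s = toℕ-injective (CycStep-functional (toℕ<n v) (toℕ<n (next u)) s (CycStep-next u))

  module CycleWord (D : Rel K) (D-orient : IsOrientationOf (CycleEdge K) D) where

    word : Word
    word = tabulate λ u → direction (to (proj₂ D-orient u (next u)) (inj₁ (CycStep-next u)))

    word-length : length word ≡ K
    word-length = length-tabulate _

    labelled : ∀ u v → CycNext K u v → Σ (D u v ⊎ D v u) λ d → letter word (toℕ u) ≡ direction d
    labelled u v s with next-unique s
    ... | refl = _ , letter-tabulate _ u

    D⇔CycleOrientation : ∀ u v → D u v ⇔ CycleOrientation word u v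
    D⇔CycleOrientation = orientation⇔Orient D (proj₂ (proj₁ D-orient))
      (λ u v d → from (proj₂ D-orient u v) (inj₁ d)) labelled

    word-periodic : ∀ F → All (Fits K) F → Free F D → Periodic (Forbidden F) K word
    word-periodic F fits free =
      subst (InL (Forbidden F)) (++-identityʳ word) (powers 1) , word-length , λ n _ → powers n
      where
      induce : ∀ n {H} → Fits K H → OccursIn H (pow word n) → InducedIn H D
      induce n {H} fits occ = InducedIn-resp {H} (λ u v → ⇔-sym (D⇔CycleOrientation u v))
        (occurs-pow⇒induced word {H} word-length fits n occ)
      powers : ∀ n → InL (Forbidden F) (pow word n)
      powers n = ¬forbidden⇒InL F (pow word n)
        (free⇒¬forbidden {D = D} F (pow word n) (All.map (λ {H} → induce n {H}) fits) free)

  CycleOrientation-free : ∀ F a → length a ≡ K → All (Fits K) F →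
    InL (Forbidden F) (pow a 2) → Free F (CycleOrientation a)
  CycleOrientation-free F a a-len fits inL = ¬forbidden⇒free {D = CycleOrientation a} F (pow a 2)
    (All.map (λ {H} → induced⇒occurs-pow2 a {H} a-len) fits) (InL⇒¬ inL)

  next-fin% : ∀ i → next (fin% i) ≡ fin% (suc i)
  next-fin% i = toℕ-injective (begin
    toℕ (next (fin% i))     ≡⟨ toℕ-fin% (suc (toℕ (fin% i))) ⟩
    suc (toℕ (fin% i)) % K  ≡⟨ cong (λ r → suc r % K) (toℕ-fin% i) ⟩
    suc (i % K) % K         ≡⟨ sym (suc-% i) ⟩
    suc i % K               ≡⟨ sym (toℕ-fin% (suc i)) ⟩
    toℕ (fin% (suc i))      ∎)
    where open ≡-Reasoning

  walk-around : (R : Rel K) → (∀ u → R u (next u)) → ∀ n → DWalk R (fin% 0) (fin% (suc n))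
  walk-around R R-next zero    = one (subst (R (fin% 0)) (next-fin% 0) (R-next (fin% 0)))
  walk-around R R-next (suc n) =
    DWalk-snoc (walk-around R R-next n) (subst (R (fin% (suc n))) (next-fin% (suc n)) (R-next (fin% (suc n))))

  closed-walk : (R : Rel K) → (∀ u → R u (next u)) → DWalk R (fin% 0) (fin% 0)
  closed-walk R R-next = subst (DWalk R (fin% 0)) fin%K≡fin%0
    (subst (λ n → DWalk R (fin% 0) (fin% n)) (suc-pred K) (walk-around R R-next (pred K)))
    where
    fin%K≡fin%0 : fin% K ≡ fin% 0
    fin%K≡fin%0 = toℕ-injective (trans (toℕ-fin% K) (trans ([m+n]%n≡m%n 0 K) (sym (toℕ-fin% 0))))

  constant⇒cyclic : ∀ a → length a ≡ K → Constant a → ¬ Acyclic (CycleOrientation a)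
  constant⇒cyclic a refl (right , all) acyclic =
    acyclic (fin% 0) (closed-walk (CycleOrientation a) λ u → inj₁ (CycStep-next u , letter-All a all (toℕ<n u)))
  constant⇒cyclic a refl (left , all) acyclic =
    acyclic (fin% 0) (DWalk-reverse (closed-walk (λ u v → CycleOrientation a v u)
                                                 λ u → inj₂ (CycStep-next u , letter-All a all (toℕ<n u))))

  -- Along a walk all arcs agree with the cyclic order or all oppose it, so one of the
  -- potentials unwind j (j a ←-position) and unwind i (i a →-position) is strictly monotone.
  module NonConstant (a : Word) {j i} (j<K : j < K) (i<K : i < K)
                     (left-j : letter a j ≡ left) (right-i : letter a i ≡ right) where

    forward : ∀ {t t′} → CycStep t t′ → letter a t ≡ right → unwind j t < unwind j t′
    forward s r = unwind-rises j<K (λ { refl → right≢left (trans (sym r) left-j) }) s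

    backward : ∀ {t t′} → CycStep t t′ → letter a t ≡ left → unwind i t < unwind i t′
    backward s l = unwind-rises i<K (λ { refl → right≢left (trans (sym right-i) l) }) s

    Monotone : Fin K → Fin K → Set
    Monotone x y = (letter a (toℕ x) ≡ right × unwind j (toℕ x) < unwind j (toℕ y))
                 ⊎ ((∃ λ t → CycStep t (toℕ x) × letter a t ≡ left) × unwind i (toℕ y) < unwind i (toℕ x))

    walk-monotone : ∀ {x y} → DWalk (CycleOrientation a) x y → Monotone x y
    walk-monotone         (one (inj₁ (s , r))) = inj₁ (r , forward s r)
    walk-monotone {y = y} (one (inj₂ (s , l))) = inj₂ ((toℕ y , s , l) , backward s l)
    walk-monotone (more (inj₁ (s , r)) w) with walk-monotone w
    ... | inj₁ (_ , rises)        = inj₁ (r , <-trans (forward s r) rises)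
    ... | inj₂ ((t , s′ , l) , _) =
      contradiction (trans (sym r) (subst (λ t → letter a t ≡ left) (CycStep-injective s′ s) l)) right≢left
    walk-monotone (more {y = y} (inj₂ (s , l)) w) with walk-monotone w
    ... | inj₁ (r , _)     = contradiction (trans (sym r) l) right≢left
    ... | inj₂ (_ , falls) = inj₂ ((toℕ y , s , l) , <-trans falls (backward s l))

    acyclic : Acyclic (CycleOrientation a)
    acyclic x w with walk-monotone w
    ... | inj₁ (_ , rises) = <-irrefl refl rises
    ... | inj₂ (_ , falls) = <-irrefl refl falls

  nonconstant⇒acyclic : ∀ a → length a ≡ K → ¬ Constant a → Acyclic (CycleOrientation a)
  nonconstant⇒acyclic a refl ¬const with nonconstant⇒letter ¬const left | nonconstant⇒letter ¬const right
  ... | j , j<K , left-j | i , i<K , right-i = NonConstant.acyclic a j<K i<K left-j right-i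

  cycle-orientation⇔periodic : ∀ F → 2 < K → All (Fits K) F →
    HasFreeOrientation F K (CycleEdge K) ⇔ (∃ λ w → Periodic (Forbidden F) K w)
  cycle-orientation⇔periodic F 2<K fits = mk⇔ toWord fromWord
    where
    toWord : HasFreeOrientation F K (CycleEdge K) → ∃ λ w → Periodic (Forbidden F) K w
    toWord (D , D-orient , free) = word , word-periodic F fits free
      where open CycleWord D D-orient
    fromWord : (∃ λ w → Periodic (Forbidden F) K w) → HasFreeOrientation F K (CycleEdge K)
    fromWord (a , (_ , a-len , powers)) = CycleOrientation a , CycleOrientation-isOrientation 2<K a ,
      CycleOrientation-free F a a-len fits (powers 2 (s≤s z≤n))

  acyclic-orientation⇔nonconstant : ∀ F → 2 < K → All (Fits K) F →
    HasAcyclicFreeOrientation F K (CycleEdge K) ⇔ (∃ λ w → Periodic (Forbidden F) K w × ¬ Constant w)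
  acyclic-orientation⇔nonconstant F 2<K fits = mk⇔ toWord fromWord
    where
    toWord : HasAcyclicFreeOrientation F K (CycleEdge K) → ∃ λ w → Periodic (Forbidden F) K w × ¬ Constant w
    toWord (D , D-orient , acyclic , free) = word , word-periodic F fits free , λ const →
      constant⇒cyclic word word-length const (Acyclic-resp (λ {u v} → from (D⇔CycleOrientation u v)) acyclic)
      where open CycleWord D D-orient
    fromWord : (∃ λ w → Periodic (Forbidden F) K w × ¬ Constant w) → HasAcyclicFreeOrientation F K (CycleEdge K)
    fromWord (a , (_ , a-len , powers) , ¬const) = CycleOrientation a , CycleOrientation-isOrientation 2<K a ,
      nonconstant⇒acyclic a a-len ¬const , CycleOrientation-free F a a-len fits (powers 2 (s≤s z≤n))

lemma3 : (F : List OGraph) → All Connected F →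
    Σ (Word → Set) λ A → Σ ℕ λ m → 1 ≤ m ×
      (∀ (k : ℕ) → 1 ≤ k →
        (m ≤ k → (HasFreeOrientation F (suc k) (PathEdge k) ⇔ (∃ λ w → length w ≡ k × InL A w)))
        × (m ≤ k → 4 ≤ k → (HasFreeOrientation F k (CycleEdge k) ⇔ (∃ λ w → Periodic A k w)))
        × (m ≤ k → 4 ≤ k → (HasAcyclicFreeOrientation F k (CycleEdge k) ⇔ (∃ λ w → Periodic A k w × ¬ Constant w))))
lemma3 F connected = Forbidden F , suc m , s≤s z≤n , λ k _ →
  (λ _ → path-orientation⇔word F k) ,
  -- Matching on 4 ≤ k exposes k = suc _, so that the instance NonZero k is found.
  (λ { m<k 4≤k@(s≤s _) → Cycle.cycle-orientation⇔periodic k F (2<k 4≤k) (fits m<k) }) ,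
  (λ { m<k 4≤k@(s≤s _) → Cycle.acyclic-orientation⇔nonconstant k F (2<k 4≤k) (fits m<k) })
  where
  common : ∃ λ m → All (Fits m) F
  common = common-fit F (All.map (λ {H} → connected⇒fits {H}) connected)
  m : ℕ
  m = proj₁ common
  fits : ∀ {k} → m < k → All (Fits k) F
  fits m<k = All.map (λ {H} → Fits-mono {H = H} (<⇒≤ m<k)) (proj₂ common)
  2<k : ∀ {k} → 4 ≤ k → 2 < k
  2<k = ≤-trans (n≤1+n 3)
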